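{- Let $k\geq2$ and let $G$ be a finite abelian CI-group with the $k$-if property. Then every Sylow subgroup of $G$ is elementary abelian.
   Context: For a finite group $G$ let $G^*=G\setminus\{1\}$. For an inverse-closed $S\subseteq G^*$, $\mathrm{Cay}(G,S)$ has vertex set $G$ and edges $\{h,g\}$ with $gh^{ -1}\in S$. $G$ is a CI-group if for all inverse-closed $S,T\subseteq G^*$, $\mathrm{Cay}(G,S)\cong\mathrm{Cay}(G,T)$ implies $T=S^{\alpha}$ for some $\alpha\in\mathrm{Aut}(G)$. A partition of a set is a collection of non-empty pairwise disjoint subsets whose union is the set. $\mathrm{Cay}(G,S)$ is a $k$-if Cayley graph if there is a partition $\{S_0=S,\dots,S_{k-1}\}$ of $G^*$ into inverse-closed subsets with $\mathrm{Cay}(G,S_i)\cong\mathrm{Cay}(G,S)$ for all $i$; $G$ has the $k$-if property if some $\mathrm{Cay}(G,S)$ is a $k$-if Cayley graph. -}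

module Defs where

open import Data.Nat using (ℕ; zero; suc; _^_; _≤_)
open import Data.Nat.Divisibility using (_∣_)
open import Data.Nat.Primality using (Prime)
open import Data.Fin using (Fin)
open import Data.Fin.Subset using (Subset; _∈_; _∉_; ∣_∣)
open import Data.Product using (Σ; ∃; _×_)
open import Function.Definitions using (Bijective)
open import Relation.Binary.PropositionalEquality using (_≡_; _≢_)
open import Relation.Nullary using (¬_)
open import Algebra.Structures using (IsGroup)
open import Algebra.Definitions using (Commutative)
open import Function.Bundles using (_⇔_)

record FinGroup : Set where
  field
    order : ℕ
    _∙_   : Fin order → Fin order → Fin order
    ε     : Fin order
    _⁻¹   : Fin order → Fin order
    isGroup : IsGroup _≡_ _∙_ ε _⁻¹

module _ (G : FinGroup) where
  open FinGroup G

  Abelian : Set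
  Abelian = Commutative _≡_ _∙_

  pow : Fin order → ℕ → Fin order
  pow x zero    = ε
  pow x (suc m) = x ∙ pow x m

  InvClosedStar : Subset order → Set
  InvClosedStar S = (ε ∉ S) × (∀ x → x ∈ S → (x ⁻¹) ∈ S)

  -- Cay(G,S) ≅ Cay(G,T): a bijection of vertices preserving adjacency and
  -- non-adjacency, where {h,g} is an edge iff g h⁻¹ ∈ S.
  CayIso : Subset order → Subset order → Set
  CayIso S T = Σ (Fin order → Fin order) λ f → Bijective _≡_ _≡_ f ×
    (∀ g h → ((g ∙ (h ⁻¹)) ∈ S) ⇔ ((f g ∙ (f h ⁻¹)) ∈ T))

  IsAut : (Fin order → Fin order) → Set
  IsAut α = Bijective _≡_ _≡_ α × (∀ x y → α (x ∙ y) ≡ α x ∙ α y)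

  IsCI : Set
  IsCI = ∀ S T → InvClosedStar S → InvClosedStar T → CayIso S T →
    Σ (Fin order → Fin order) λ α → IsAut α × (∀ x → (x ∈ S) ⇔ (α x ∈ T))

  IsInvClosedPartition : (k : ℕ) → (Fin k → Subset order) → Set
  IsInvClosedPartition k P =
      (∀ i → InvClosedStar (P i))
    × (∀ i → ∃ λ x → x ∈ P i)
    × (∀ i j x → i ≢ j → x ∈ P i → x ∉ P j)
    × (∀ x → x ≢ ε → ∃ λ i → x ∈ P i)

  IsKIfCayley : ℕ → Subset order → Set
  IsKIfCayley k S = Σ (Fin k → Subset order) λ P → IsInvClosedPartition k P
    × (∃ λ i₀ → P i₀ ≡ S) × (∀ i → CayIso (P i) S)

  HasKIf : ℕ → Set
  HasKIf k = ∃ λ S → IsKIfCayley k S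

  IsSubgroup : Subset order → Set
  IsSubgroup H = (ε ∈ H) × (∀ x y → x ∈ H → y ∈ H → (x ∙ y) ∈ H)
    × (∀ x → x ∈ H → (x ⁻¹) ∈ H)

  IsSylow : ℕ → Subset order → Set
  IsSylow p H = Prime p × IsSubgroup H ×
    (∃ λ a → (∣ H ∣ ≡ p ^ a) × ¬ ((p ^ suc a) ∣ order))

  ElementaryAbelianP : ℕ → Subset order → Set
  ElementaryAbelianP p H = (∀ x y → x ∈ H → y ∈ H → x ∙ y ≡ y ∙ x)
    × (∀ x → x ∈ H → pow x p ≡ ε)

-- By Lagrange's theorem every x in the Sylow subgroup satisfies x ^ (p ^ a) = 1, so if some x ^ p ≠ 1,
-- a power y of x has order p², and z = y ^ p has order p. Such a y is ruled out as follows.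
-- Let K ∋ z be a subgroup of exponent p with an automorphism β such that β z ∉ {z, z⁻¹}, and let
-- A = y K ∪ y⁻¹ K. Applying β inside every coset of K is an isomorphism between the Cayley graphs on
-- A ∪ {z, z⁻¹} and A ∪ {β z, (β z)⁻¹}, but no automorphism of G maps the first connection set onto
-- the second, so G is not CI. For p > 3 take K = {x | x ^ p = 1} and β = squaring; if G has an
-- element w of order p outside ⟨z⟩, take K = ⟨z⟩ × ⟨w⟩ and β the coordinate swap. Otherwise
-- p ∈ {2, 3} and z, z⁻¹ are the only elements of order p, so they lie in a single part of the k-if
-- partition, whereas by the CI property every part is an automorphic image of S and hence contains
-- an element of order p.
module Submission where

open import Defs
open import Data.Nat using (ℕ; _≤_)

open import Algebra.Bundles using (AbelianGroup)
open import Level using (0ℓ)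
open import Data.Bool using (true; false; if_then_else_)
open import Data.Empty using (⊥)
open import Data.Fin as Fin using (Fin; toℕ; fromℕ<)
open import Data.Fin.Properties using (any?; toℕ<n; toℕ-fromℕ<) renaming (_≟_ to _≟ᶠ_)
open import Data.Fin.Subset using (Subset; _∈_; _∉_; ∣_∣)
open import Data.Fin.Subset.Properties using (nonempty?; _∈?_)
open import Data.Fin.Permutation using (Permutation′; permutation)
open import Data.Nat as ℕ using (zero; suc; _+_; _*_; _<_; _<?_; NonZero; s≤s)
open import Data.Nat.Coprimality using (Coprime; coprime-Bézout; prime⇒coprime) renaming (sym to coprime-sym)
open import Data.Nat.Primality using (Prime; prime⇒irreducible; prime⇒nonZero)
open import Data.Nat.Divisibility using (_∣_; _∣?_; divides)
import Data.Nat.GCD as GCD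
open import Data.Nat.DivMod using (_%_; _/_; m≡m%n+[m/n]*n; m%n<n)
import Data.Nat.Properties as ℕₚ
open import Data.Sum using (_⊎_; inj₁; inj₂; [_,_]′) renaming (map to ⊎-map)
open import Data.Sum.Function.Propositional using (_⊎-⇔_)
open import Data.Product using (Σ; ∃; ∃₂; _×_; _,_; proj₁; proj₂)
open import Data.Vec using ([]; _∷_; lookup; tabulate)
open import Data.Vec.Properties using ([]=↔lookup; lookup∘tabulate; tabulate-cong)
open import Function.Base using (_∘_; const; id)
open import Function.Bundles using (_⇔_; mk⇔; Equivalence)
open import Function.Properties.Inverse using (↔⇒⇔)
open import Function.Construct.Composition using (_⇔-∘_)
open import Function.Construct.Symmetry using (⇔-sym)
open import Function.Consequences.Propositional using (strictlySurjective⇒surjective)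
open import Relation.Binary.PropositionalEquality
open import Relation.Nullary using (Dec; yes; no; does; ¬_; contradiction)
open import Relation.Nullary.Decidable using (does-⇔; _⊎-dec_; _×-dec_; ¬?; map′; decidable-stable)
open import Relation.Unary using (Pred; Decidable)

does≡true⇔ : ∀ {a} {A : Set a} (a? : Dec A) → does a? ≡ true ⇔ A
does≡true⇔ (yes a) = mk⇔ (const a) (const refl)
does≡true⇔ (no ¬a) = mk⇔ (λ ()) (λ a → contradiction a ¬a)

module _ {n : ℕ} where

  subsetOf : ∀ {ℓ} {P : Pred (Fin n) ℓ} → Decidable P → Subset n
  subsetOf P? = tabulate (does ∘ P?)

  ∈-subsetOf : ∀ {ℓ} {P : Pred (Fin n) ℓ} (P? : Decidable P) {x} → x ∈ subsetOf P? ⇔ P x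
  ∈-subsetOf P? {x} = mk⇔
    (λ x∈ → Equivalence.to (does≡true⇔ (P? x))
               (trans (sym (lookup∘tabulate (does ∘ P?) x)) (Equivalence.to (↔⇒⇔ []=↔lookup) x∈)))
    (λ Px → Equivalence.from (↔⇒⇔ []=↔lookup)
               (trans (lookup∘tabulate (does ∘ P?) x) (Equivalence.from (does≡true⇔ (P? x)) Px)))

  subsetOf-cong : ∀ {ℓ} {P Q : Pred (Fin n) ℓ} (P? : Decidable P) (Q? : Decidable Q) →
                  (∀ x → P x ⇔ Q x) → subsetOf P? ≡ subsetOf Q?
  subsetOf-cong P? Q? P⇔Q = tabulate-cong (λ x → does-⇔ (P⇔Q x) (P? x) (Q? x))

  choose : Subset n → Fin n → Fin n
  choose p d with nonempty? p
  ... | yes (x , _) = x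
  ... | no _        = d

  choose-∈ : ∀ {p d} → d ∈ p → choose p d ∈ p
  choose-∈ {p} {d} d∈p with nonempty? p
  ... | yes (_ , x∈p) = x∈p
  ... | no  ∅         = contradiction (d , d∈p) ∅

  choose-default : ∀ {p d e} → d ∈ p → choose p d ≡ choose p e
  choose-default {p} d∈p with nonempty? p
  ... | yes _ = refl
  ... | no  ∅ = contradiction (_ , d∈p) ∅

coprime-below-prime : ∀ {d p} → Prime p → .{{NonZero d}} → d < p → Coprime d p
coprime-below-prime p-prime d<p = coprime-sym (prime⇒coprime p-prime d<p)

prime∤⇒coprime : ∀ {p e} → Prime p → ¬ p ∣ e → Coprime e p
prime∤⇒coprime p-prime p∤e (d∣e , d∣p) with prime⇒irreducible p-prime d∣p
... | inj₁ d≡1  = d≡1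
... | inj₂ refl = contradiction d∣e p∤e

other-index : ∀ {k} → 2 ≤ k → (a : Fin k) → ∃ λ b → a ≢ b
other-index (s≤s (s≤s _)) Fin.zero    = Fin.suc Fin.zero , λ ()
other-index (s≤s (s≤s _)) (Fin.suc _) = Fin.zero , λ ()

module AbelianFinGroup (G : FinGroup) (comm : Abelian G) where

  open FinGroup G public using (order; ε; isGroup) renaming (_∙_ to infixl 7 _∙_; _⁻¹ to infix 8 _⁻¹)

  abelianGroup : AbelianGroup 0ℓ 0ℓ
  abelianGroup = record { isAbelianGroup = record { isGroup = isGroup ; comm = comm } }

  open AbelianGroup abelianGroup
    using (assoc; identityˡ; identityʳ; inverseˡ; inverseʳ; commutativeMonoid; commutativeSemigroup)
  open import Algebra.Properties.AbelianGroup abelianGroup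
    using (⁻¹-involutive; ⁻¹-injective; ⁻¹-∙-comm; ⁻¹-anti-homo-∙; ε⁻¹≈ε; inverseʳ-unique; x∙y⁻¹≈ε⇒x≈y;
           identityˡ-unique; identityʳ-unique; ∙-cancelˡ; \\-leftDividesˡ; \\-leftDividesʳ; //-rightDividesʳ)
  open import Algebra.Properties.CommutativeSemigroup commutativeSemigroup using (interchange)
  open import Algebra.Properties.CommutativeMonoid.Mult commutativeMonoid
    using (×-homo-1; ×-homo-+; ×-assocˡ; ×-distrib-+) renaming (_×_ to _times_)
  open import Algebra.Properties.CommutativeMonoid.Sum commutativeMonoid
    using (sum; sum-permute; ∑-distrib-+; sum-cong-≗)
  open ≡-Reasoning

  -- Opaque, so that exponents and bases can be inferred from equations between powers.
  infix 9 _^_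
  opaque
    _^_ : Fin order → ℕ → Fin order
    x ^ n = n times x

    ^-zero : ∀ x → x ^ 0 ≡ ε
    ^-zero x = refl

    ^-suc : ∀ x n → x ^ suc n ≡ x ∙ x ^ n
    ^-suc x n = refl

    ^-identityʳ : ∀ x → x ^ 1 ≡ x
    ^-identityʳ = ×-homo-1

    ^-homo-+ : ∀ x m n → x ^ (m + n) ≡ x ^ m ∙ x ^ n
    ^-homo-+ = ×-homo-+

    ^-assoc : ∀ x m n → (x ^ n) ^ m ≡ x ^ (m * n)
    ^-assoc = ×-assocˡ

    ^-distrib-∙ : ∀ x y n → (x ∙ y) ^ n ≡ x ^ n ∙ y ^ n
    ^-distrib-∙ = ×-distrib-+

    pow≡^ : ∀ x n → pow G x n ≡ x ^ n
    pow≡^ x zero    = refl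
    pow≡^ x (suc n) = cong (x ∙_) (pow≡^ x n)

  ε^ : ∀ n → ε ^ n ≡ ε
  ε^ zero    = ^-zero ε
  ε^ (suc n) = trans (^-suc ε n) (trans (identityˡ _) (ε^ n))

  ^-multiple : ∀ {x n} m → x ^ n ≡ ε → x ^ (m * n) ≡ ε
  ^-multiple {x} {n} m xⁿ≡ε = begin
    x ^ (m * n) ≡⟨ ^-assoc x m n ⟨
    (x ^ n) ^ m ≡⟨ cong (_^ m) xⁿ≡ε ⟩
    ε ^ m       ≡⟨ ε^ m ⟩
    ε           ∎

  ^-comm : ∀ x m n → (x ^ m) ^ n ≡ (x ^ n) ^ m
  ^-comm x m n = trans (^-assoc x n m) (trans (cong (x ^_) (ℕₚ.*-comm n m)) (sym (^-assoc x m n)))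

  ⁻¹-^ : ∀ x n → (x ⁻¹) ^ n ≡ (x ^ n) ⁻¹
  ⁻¹-^ x n = inverseʳ-unique (x ^ n) ((x ⁻¹) ^ n) (begin
    x ^ n ∙ (x ⁻¹) ^ n ≡⟨ ^-distrib-∙ x (x ⁻¹) n ⟨
    (x ∙ x ⁻¹) ^ n     ≡⟨ cong (_^ n) (inverseʳ x) ⟩
    ε ^ n              ≡⟨ ε^ n ⟩
    ε                  ∎)

  ⁻¹≡^pred : ∀ {x} n .{{_ : NonZero n}} → x ^ n ≡ ε → x ⁻¹ ≡ x ^ ℕ.pred n
  ⁻¹≡^pred {x} (suc m) xⁿ≡ε = sym (inverseʳ-unique x (x ^ m) (trans (sym (^-suc x m)) xⁿ≡ε))

  ^-exponent : ∀ {x n} m → x ^ n ≡ ε → (x ^ m) ^ n ≡ ε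
  ^-exponent {x} {n} m xⁿ≡ε = trans (^-comm x m n) (trans (cong (_^ m) xⁿ≡ε) (ε^ m))

  //-^ : ∀ x y n → (x ∙ y ⁻¹) ^ n ≡ x ^ n ∙ (y ^ n) ⁻¹
  //-^ x y n = trans (^-distrib-∙ x (y ⁻¹) n) (cong (x ^ n ∙_) (⁻¹-^ y n))

  ^-mod : ∀ {x} n .{{_ : NonZero n}} → x ^ n ≡ ε → ∀ m → x ^ m ≡ x ^ (m % n)
  ^-mod {x} n xⁿ≡ε m = begin
    x ^ m                               ≡⟨ cong (x ^_) (m≡m%n+[m/n]*n m n) ⟩
    x ^ (m % n + (m / n) * n)           ≡⟨ ^-homo-+ x (m % n) _ ⟩
    x ^ (m % n) ∙ x ^ ((m / n) * n)     ≡⟨ cong (x ^ (m % n) ∙_) (^-multiple (m / n) xⁿ≡ε) ⟩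
    x ^ (m % n) ∙ ε                     ≡⟨ identityʳ _ ⟩
    x ^ (m % n)                         ∎

  xy⁻¹-interchange : ∀ x y u v → (x ∙ y) ∙ (u ∙ v) ⁻¹ ≡ (x ∙ u ⁻¹) ∙ (y ∙ v ⁻¹)
  xy⁻¹-interchange x y u v = trans (cong ((x ∙ y) ∙_) (sym (⁻¹-∙-comm u v))) (interchange x y (u ⁻¹) (v ⁻¹))

  -- The two Bézout cases exhibit x, respectively x ⁻¹, as a power of x ^ d.
  ^-root : ∀ {d n x} → Coprime d n → x ^ n ≡ ε → ∃ λ c → (x ^ d) ^ c ≡ x
  ^-root {d} {n} {x} d⊥n xⁿ≡ε with coprime-Bézout d⊥n
  ... | GCD.Bézout.+- a b 1+bn≡ad = a , (begin
    (x ^ d) ^ a       ≡⟨ ^-assoc x a d ⟩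
    x ^ (a * d)       ≡⟨ cong (x ^_) 1+bn≡ad ⟨
    x ^ suc (b * n)   ≡⟨ ^-suc x _ ⟩
    x ∙ x ^ (b * n)   ≡⟨ cong (x ∙_) (^-multiple b xⁿ≡ε) ⟩
    x ∙ ε             ≡⟨ identityʳ x ⟩
    x                 ∎)
  ... | GCD.Bézout.-+ a b 1+ad≡bn with n
  ...   | zero  = contradiction (trans 1+ad≡bn (ℕₚ.*-zeroʳ b)) λ ()
  ...   | suc m = m * a , (begin
    (x ^ d) ^ (m * a) ≡⟨ ^-assoc (x ^ d) m a ⟨
    ((x ^ d) ^ a) ^ m ≡⟨ cong (_^ m) xᵈᵃ≡x⁻¹ ⟩
    (x ⁻¹) ^ m        ≡⟨ ⁻¹-^ x m ⟩
    (x ^ m) ⁻¹        ≡⟨ cong _⁻¹ (⁻¹≡^pred (suc m) xⁿ≡ε) ⟨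
    x ⁻¹ ⁻¹           ≡⟨ ⁻¹-involutive x ⟩
    x                 ∎)
    where
    xᵈᵃ≡x⁻¹ : (x ^ d) ^ a ≡ x ⁻¹
    xᵈᵃ≡x⁻¹ = inverseʳ-unique x _ (begin
      x ∙ (x ^ d) ^ a   ≡⟨ cong (x ∙_) (^-assoc x a d) ⟩
      x ∙ x ^ (a * d)   ≡⟨ ^-suc x _ ⟨
      x ^ suc (a * d)   ≡⟨ cong (x ^_) 1+ad≡bn ⟩
      x ^ (b * suc m)   ≡⟨ ^-multiple b xⁿ≡ε ⟩
      ε                 ∎)

  ^-coprime-trivial : ∀ {d n x} → Coprime d n → x ^ d ≡ ε → x ^ n ≡ ε → x ≡ ε
  ^-coprime-trivial {d} {x = x} d⊥n xᵈ≡ε xⁿ≡ε with ^-root d⊥n xⁿ≡ε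
  ... | c , xᵈᶜ≡x = trans (sym xᵈᶜ≡x) (trans (cong (_^ c) xᵈ≡ε) (ε^ c))

  ^-∣ : ∀ {x n e} → x ^ n ≡ ε → n ∣ e → x ^ e ≡ ε
  ^-∣ xⁿ≡ε (divides q refl) = ^-multiple q xⁿ≡ε

  ^-prime-order : ∀ {p x e} → Prime p → x ≢ ε → x ^ p ≡ ε → x ^ e ≡ ε → p ∣ e
  ^-prime-order {p} {e = e} p-prime x≢ε xᵖ≡ε xᵉ≡ε with p ∣? e
  ... | yes p∣e = p∣e
  ... | no  p∤e = contradiction (^-coprime-trivial (prime∤⇒coprime p-prime p∤e) xᵉ≡ε xᵖ≡ε) x≢ε

  -- a + pred n * c represents a - c modulo n.
  ^-minus : ∀ {x} n .{{_ : NonZero n}} → x ^ n ≡ ε → ∀ a c → x ^ (a + ℕ.pred n * c) ≡ x ^ a ∙ (x ^ c) ⁻¹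
  ^-minus {x} n xⁿ≡ε a c = begin
    x ^ (a + ℕ.pred n * c)       ≡⟨ ^-homo-+ x a _ ⟩
    x ^ a ∙ x ^ (ℕ.pred n * c)   ≡⟨ cong (x ^ a ∙_) (^-assoc x (ℕ.pred n) c) ⟨
    x ^ a ∙ (x ^ c) ^ ℕ.pred n   ≡⟨ cong (x ^ a ∙_) (⁻¹≡^pred n (^-exponent c xⁿ≡ε)) ⟨
    x ^ a ∙ (x ^ c) ⁻¹           ∎

  ^-transfer : ∀ {p x y a c} → Prime p → x ≢ ε → x ^ p ≡ ε → y ^ p ≡ ε → x ^ a ≡ x ^ c → y ^ a ≡ y ^ c
  ^-transfer {p} {x} {y} {a} {c} p-prime x≢ε xᵖ≡ε yᵖ≡ε xᵃ≡xᶜ = x∙y⁻¹≈ε⇒x≈y (y ^ a) (y ^ c) (begin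
    y ^ a ∙ (y ^ c) ⁻¹        ≡⟨ ^-minus p yᵖ≡ε a c ⟨
    y ^ (a + ℕ.pred p * c)    ≡⟨ ^-∣ yᵖ≡ε (^-prime-order p-prime x≢ε xᵖ≡ε xᵃ⁻ᶜ≡ε) ⟩
    ε                         ∎)
    where
    instance
      p≢0 : NonZero p
      p≢0 = prime⇒nonZero p-prime
    xᵃ⁻ᶜ≡ε : x ^ (a + ℕ.pred p * c) ≡ ε
    xᵃ⁻ᶜ≡ε = trans (^-minus p xᵖ≡ε a c) (trans (cong (_∙ (x ^ c) ⁻¹) xᵃ≡xᶜ) (inverseʳ (x ^ c)))

  ^-coprime-injective : ∀ {d n x y} → Coprime d n → x ^ n ≡ ε → y ^ n ≡ ε → x ^ d ≡ y ^ d → x ≡ y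
  ^-coprime-injective {d} {n} {x} {y} d⊥n xⁿ≡ε yⁿ≡ε xᵈ≡yᵈ = x∙y⁻¹≈ε⇒x≈y x y (^-coprime-trivial d⊥n
    (trans (//-^ x y d) (trans (cong (_∙ (y ^ d) ⁻¹) xᵈ≡yᵈ) (inverseʳ (y ^ d))))
    (trans (//-^ x y n) (trans (cong₂ (λ u v → u ∙ v ⁻¹) xⁿ≡ε yⁿ≡ε) (inverseʳ ε))))

  cancel-// : ∀ r x y → (r ∙ x) ∙ (r ∙ y) ⁻¹ ≡ x ∙ y ⁻¹
  cancel-// r x y = begin
    (r ∙ x) ∙ (r ∙ y) ⁻¹        ≡⟨ xy⁻¹-interchange r x r y ⟩
    (r ∙ r ⁻¹) ∙ (x ∙ y ⁻¹)     ≡⟨ cong (_∙ (x ∙ y ⁻¹)) (inverseʳ r) ⟩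
    ε ∙ (x ∙ y ⁻¹)              ≡⟨ identityˡ _ ⟩
    x ∙ y ⁻¹                    ∎

  sum-if : ∀ {m} x (v : Subset m) → sum (λ i → if lookup v i then x else ε) ≡ x ^ ∣ v ∣
  sum-if x []          = sym (^-zero x)
  sum-if x (true ∷ v)  = trans (cong (x ∙_) (sum-if x v)) (sym (^-suc x _))
  sum-if x (false ∷ v) = trans (identityˡ _) (sum-if x v)

  module Subgroup {K : Subset order} (K≤G : IsSubgroup G K) where

    ε∈ : ε ∈ K
    ε∈ = proj₁ K≤G

    ∙-closed : ∀ {x y} → x ∈ K → y ∈ K → x ∙ y ∈ K
    ∙-closed = proj₁ (proj₂ K≤G) _ _

    ⁻¹-closed : ∀ {x} → x ∈ K → x ⁻¹ ∈ K
    ⁻¹-closed = proj₂ (proj₂ K≤G) _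

    ∈⇔lookup : ∀ {x} → x ∈ K ⇔ lookup K x ≡ true
    ∈⇔lookup = ↔⇒⇔ []=↔lookup

    -- Multiplication by x ∈ K permutes K, so ∏ K = x ^ ∣ K ∣ ∙ ∏ K.
    lagrange : ∀ {x} → x ∈ K → x ^ ∣ K ∣ ≡ ε
    lagrange {x} x∈K = identityˡ-unique (x ^ ∣ K ∣) (sum restrict) (begin
      x ^ ∣ K ∣ ∙ sum restrict                                 ≡⟨ cong (_∙ sum restrict) (sum-if x K) ⟨
      sum (λ g → if lookup K g then x else ε) ∙ sum restrict   ≡⟨ ∑-distrib-+ _ restrict ⟨
      sum (λ g → (if lookup K g then x else ε) ∙ restrict g)   ≡⟨ sum-cong-≗ shift ⟨
      sum (restrict ∘ (x ∙_))                                  ≡⟨ sum-permute restrict translation ⟨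
      sum restrict                                             ∎)
      where
      restrict : Fin order → Fin order
      restrict g = if lookup K g then g else ε

      translation : Permutation′ order
      translation = permutation (x ∙_) (x ⁻¹ ∙_) (\\-leftDividesˡ x) (\\-leftDividesʳ x)

      shift : ∀ g → restrict (x ∙ g) ≡ (if lookup K g then x else ε) ∙ restrict g
      shift g with lookup K g in g∈? | lookup K (x ∙ g) in xg∈?
      ... | true  | true  = refl
      ... | false | false = sym (identityˡ ε)
      ... | true  | false = contradiction
        (trans (sym (Equivalence.to ∈⇔lookup (∙-closed x∈K (Equivalence.from ∈⇔lookup g∈?)))) xg∈?) λ ()
      ... | false | true  = contradiction
        (trans (sym (Equivalence.to ∈⇔lookup g∈K)) g∈?) λ ()
        where
        g∈K : g ∈ K
        g∈K = subst (_∈ K) (\\-leftDividesʳ x g) (∙-closed (⁻¹-closed x∈K) (Equivalence.from ∈⇔lookup xg∈?))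

    infix 4 _∼_
    _∼_ : Fin order → Fin order → Set
    x ∼ y = x ⁻¹ ∙ y ∈ K

    ∼-refl : ∀ x → x ∼ x
    ∼-refl x = subst (_∈ K) (sym (inverseˡ x)) ε∈

    ∼-sym : ∀ {x y} → x ∼ y → y ∼ x
    ∼-sym {x} {y} x∼y = subst (_∈ K) (trans (⁻¹-anti-homo-∙ (x ⁻¹) y) (cong (y ⁻¹ ∙_) (⁻¹-involutive x)))
                                      (⁻¹-closed x∼y)

    ∼-trans : ∀ {x y z} → x ∼ y → y ∼ z → x ∼ z
    ∼-trans {x} {y} {z} x∼y y∼z = subst (_∈ K) (trans (assoc _ _ _) (cong (x ⁻¹ ∙_) (\\-leftDividesˡ y z)))
                                                (∙-closed x∼y y∼z)

    ∼-⁻¹ : ∀ {x y} → x ∼ y → x ⁻¹ ∼ y ⁻¹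
    ∼-⁻¹ {x} {y} x∼y = subst (_∈ K) (trans (⁻¹-anti-homo-∙ (x ⁻¹) y) (comm _ _)) (⁻¹-closed x∼y)

    coset : Fin order → Subset order
    coset x = subsetOf (λ y → x ⁻¹ ∙ y ∈? K)

    ∈-coset : ∀ {x y} → y ∈ coset x ⇔ x ∼ y
    ∈-coset {x} = ∈-subsetOf (λ y → x ⁻¹ ∙ y ∈? K)

    coset-cong : ∀ {x y} → x ∼ y → coset x ≡ coset y
    coset-cong {x} {y} x∼y = subsetOf-cong (λ z → x ⁻¹ ∙ z ∈? K) (λ z → y ⁻¹ ∙ z ∈? K) λ z →
      mk⇔ (∼-trans (∼-sym x∼y)) (∼-trans x∼y)

    rep : Fin order → Fin order
    rep x = choose (coset x) x

    ∼-rep : ∀ x → x ∼ rep x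
    ∼-rep x = Equivalence.to ∈-coset (choose-∈ (Equivalence.from ∈-coset (∼-refl x)))

    rep-cong : ∀ {x y} → x ∼ y → rep x ≡ rep y
    rep-cong {x} {y} x∼y = trans (choose-default (Equivalence.from ∈-coset (∼-refl x)))
                                 (cong (λ c → choose c y) (coset-cong x∼y))

  module Aut {α : Fin order → Fin order} (α-aut : IsAut G α) where

    homo : ∀ x y → α (x ∙ y) ≡ α x ∙ α y
    homo = proj₂ α-aut

    ε-homo : α ε ≡ ε
    ε-homo = identityˡ-unique (α ε) (α ε) (trans (sym (homo ε ε)) (cong α (identityˡ ε)))

    ^-homo : ∀ x n → α (x ^ n) ≡ α x ^ n
    ^-homo x zero    = trans (cong α (^-zero x)) (trans ε-homo (sym (^-zero (α x))))
    ^-homo x (suc n) = begin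
      α (x ^ suc n)     ≡⟨ cong α (^-suc x n) ⟩
      α (x ∙ x ^ n)     ≡⟨ homo x (x ^ n) ⟩
      α x ∙ α (x ^ n)   ≡⟨ cong (α x ∙_) (^-homo x n) ⟩
      α x ∙ α x ^ n     ≡⟨ ^-suc (α x) n ⟨
      α x ^ suc n       ∎

    injective : ∀ {x y} → α x ≡ α y → x ≡ y
    injective = proj₁ (proj₁ α-aut)

    surjective : ∀ y → ∃ λ x → α x ≡ y
    surjective y = proj₁ (proj₂ (proj₁ α-aut) y) , proj₂ (proj₂ (proj₁ α-aut) y) refl

    ε-reflect : ∀ {x} → α x ≡ ε → x ≡ ε
    ε-reflect αx≡ε = injective (trans αx≡ε (sym ε-homo))

  module Twist {K : Subset order} (K≤G : IsSubgroup G K) (β : Fin order → Fin order)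
               (β-closed : ∀ {k} → k ∈ K → β k ∈ K)
               (β-homo : ∀ {k l} → k ∈ K → l ∈ K → β (k ∙ l) ≡ β k ∙ β l)
               (β-injective : ∀ {k l} → k ∈ K → l ∈ K → β k ≡ β l → k ≡ l)
               (β-surjective : ∀ {k} → k ∈ K → ∃ λ l → l ∈ K × β l ≡ k)
               where
    open Subgroup K≤G

    β-ε : β ε ≡ ε
    β-ε = identityˡ-unique (β ε) (β ε) (trans (sym (β-homo ε∈ ε∈)) (cong β (identityˡ ε)))

    β-⁻¹ : ∀ {l} → l ∈ K → β (l ⁻¹) ≡ β l ⁻¹
    β-⁻¹ {l} l∈K = inverseʳ-unique (β l) (β (l ⁻¹))
      (trans (sym (β-homo l∈K (⁻¹-closed l∈K))) (trans (cong β (inverseʳ l)) β-ε))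

    β-// : ∀ {k l} → k ∈ K → l ∈ K → β (k ∙ l ⁻¹) ≡ β k ∙ β l ⁻¹
    β-// {k} k∈K l∈K = trans (β-homo k∈K (⁻¹-closed l∈K)) (cong (β k ∙_) (β-⁻¹ l∈K))

    twist : Fin order → Fin order
    twist x = rep x ∙ β (rep x ⁻¹ ∙ x)

    ∼-twist : ∀ x → x ∼ twist x
    ∼-twist x = subst (_∈ K) (assoc _ _ _) (∙-closed (∼-rep x) (β-closed (∼-sym (∼-rep x))))

    twist-injective : ∀ {x y} → twist x ≡ twist y → x ≡ y
    twist-injective {x} {y} tx≡ty = ∙-cancelˡ (rep x ⁻¹) x y (β-injective (∼-sym (∼-rep x)) rx∼y
      (∙-cancelˡ (rep x) _ _ (trans tx≡ty (cong (λ r → r ∙ β (r ⁻¹ ∙ y)) (sym rx≡ry)))))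
      where
      rx≡ry : rep x ≡ rep y
      rx≡ry = rep-cong (∼-trans (∼-twist x) (subst (_∼ y) (sym tx≡ty) (∼-sym (∼-twist y))))
      rx∼y : rep x ∼ y
      rx∼y = subst (_∼ y) (sym rx≡ry) (∼-sym (∼-rep y))

    twist-surjective : ∀ y → ∃ λ x → twist x ≡ y
    twist-surjective y with β-surjective (∼-sym (∼-rep y))
    ... | l , l∈K , βl≡ = r ∙ l , (begin
      twist (r ∙ l)               ≡⟨ cong (λ s → s ∙ β (s ⁻¹ ∙ (r ∙ l))) rep[rl]≡r ⟩
      r ∙ β (r ⁻¹ ∙ (r ∙ l))      ≡⟨ cong (λ k → r ∙ β k) (\\-leftDividesʳ r l) ⟩
      r ∙ β l                     ≡⟨ cong (r ∙_) βl≡ ⟩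
      r ∙ (r ⁻¹ ∙ y)              ≡⟨ \\-leftDividesˡ r y ⟩
      y                           ∎)
      where
      r : Fin order
      r = rep y
      rep[rl]≡r : rep (r ∙ l) ≡ r
      rep[rl]≡r = sym (rep-cong (∼-trans (∼-rep y) (subst (_∈ K) (sym (\\-leftDividesʳ r l)) l∈K)))

    twist-//-inside : ∀ {g h} → g ∙ h ⁻¹ ∈ K → twist g ∙ twist h ⁻¹ ≡ β (g ∙ h ⁻¹)
    twist-//-inside {g} {h} gh⁻¹∈K = begin
      (r ∙ β (r ⁻¹ ∙ g)) ∙ (s ∙ β (s ⁻¹ ∙ h)) ⁻¹  ≡⟨ cong (λ t → twist g ∙ (t ∙ β (t ⁻¹ ∙ h)) ⁻¹) r≡s ⟨
      (r ∙ β (r ⁻¹ ∙ g)) ∙ (r ∙ β (r ⁻¹ ∙ h)) ⁻¹  ≡⟨ cancel-// r _ _ ⟩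
      β (r ⁻¹ ∙ g) ∙ β (r ⁻¹ ∙ h) ⁻¹              ≡⟨ β-// (∼-sym (∼-rep g)) r∼h ⟨
      β ((r ⁻¹ ∙ g) ∙ (r ⁻¹ ∙ h) ⁻¹)              ≡⟨ cong β (cancel-// (r ⁻¹) g h) ⟩
      β (g ∙ h ⁻¹)                                ∎
      where
      r s : Fin order
      r = rep g
      s = rep h
      g∼h : g ∼ h
      g∼h = ∼-sym (subst (_∈ K) (comm g (h ⁻¹)) gh⁻¹∈K)
      r≡s : r ≡ s
      r≡s = rep-cong g∼h
      r∼h : r ∼ h
      r∼h = ∼-trans (∼-sym (∼-rep g)) g∼h

    twist-//-outside : ∀ g h → twist g ∙ twist h ⁻¹ ≡ (g ∙ h ⁻¹) ∙ ((g ⁻¹ ∙ twist g) ∙ (h ⁻¹ ∙ twist h) ⁻¹)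
    twist-//-outside g h = begin
      twist g ∙ twist h ⁻¹
        ≡⟨ cong₂ (λ u v → u ∙ v ⁻¹) (\\-leftDividesˡ g _) (\\-leftDividesˡ h _) ⟨
      (g ∙ (g ⁻¹ ∙ twist g)) ∙ (h ∙ (h ⁻¹ ∙ twist h)) ⁻¹
        ≡⟨ xy⁻¹-interchange g _ h _ ⟩
      (g ∙ h ⁻¹) ∙ ((g ⁻¹ ∙ twist g) ∙ (h ⁻¹ ∙ twist h) ⁻¹)
        ∎

    module _ {S T : Subset order}
             (outside : ∀ {x} → x ∉ K → x ∈ S ⇔ x ∈ T)
             (T-stable : ∀ {x k} → x ∉ K → k ∈ K → x ∙ k ∈ T ⇔ x ∈ T)
             (inside : ∀ {k} → k ∈ K → k ∈ S ⇔ β k ∈ T)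
             where

      twist-edges : ∀ g h → g ∙ h ⁻¹ ∈ S ⇔ twist g ∙ twist h ⁻¹ ∈ T
      twist-edges g h with g ∙ h ⁻¹ ∈? K
      ... | yes gh⁻¹∈K = subst (λ t → g ∙ h ⁻¹ ∈ S ⇔ t ∈ T) (sym (twist-//-inside gh⁻¹∈K)) (inside gh⁻¹∈K)
      ... | no  gh⁻¹∉K = subst (λ t → g ∙ h ⁻¹ ∈ S ⇔ t ∈ T) (sym (twist-//-outside g h))
        (⇔-sym (T-stable gh⁻¹∉K (∙-closed (∼-twist g) (⁻¹-closed (∼-twist h)))) ⇔-∘ outside gh⁻¹∉K)

      twist-cayIso : CayIso G S T
      twist-cayIso = twist , (twist-injective , strictlySurjective⇒surjective twist-surjective) , twist-edges

  infix 4 _≡±_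
  _≡±_ : Fin order → Fin order → Set
  x ≡± u = x ≡ u ⊎ x ≡ u ⁻¹

  _≡±?_ : ∀ x u → Dec (x ≡± u)
  x ≡±? u = (x ≟ᶠ u) ⊎-dec (x ≟ᶠ u ⁻¹)

  ≡±-⁻¹ : ∀ {x u} → x ≡± u → x ⁻¹ ≡± u
  ≡±-⁻¹ (inj₁ refl) = inj₂ refl
  ≡±-⁻¹ (inj₂ refl) = inj₁ (⁻¹-involutive _)

  ε≡± : ∀ {u} → ε ≡± u → u ≡ ε
  ε≡± (inj₁ refl)   = refl
  ε≡± (inj₂ ε≡u⁻¹) = ⁻¹-injective (trans (sym ε≡u⁻¹) (sym ε⁻¹≈ε))

  ≡±-unique : ∀ {x u v} → x ≡± u → x ≡± v → v ≡± u
  ≡±-unique (inj₁ refl) (inj₁ refl) = inj₁ refl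
  ≡±-unique (inj₂ refl) (inj₂ x≡v⁻¹) = inj₁ (⁻¹-injective (sym x≡v⁻¹))
  ≡±-unique (inj₁ refl) (inj₂ refl) = inj₂ (sym (⁻¹-involutive _))
  ≡±-unique (inj₂ refl) (inj₁ refl) = inj₂ refl

  module NonCI {p : ℕ} {y : Fin order} (yᵖ≢ε : y ^ p ≢ ε)
               {K : Subset order} (K≤G : IsSubgroup G K) (yᵖ∈K : y ^ p ∈ K)
               (K-exponent : ∀ {k} → k ∈ K → k ^ p ≡ ε)
               (β : Fin order → Fin order)
               (β-closed : ∀ {k} → k ∈ K → β k ∈ K)
               (β-homo : ∀ {k l} → k ∈ K → l ∈ K → β (k ∙ l) ≡ β k ∙ β l)
               (β-injective : ∀ {k l} → k ∈ K → l ∈ K → β k ≡ β l → k ≡ l)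
               (β-surjective : ∀ {k} → k ∈ K → ∃ λ l → l ∈ K × β l ≡ k)
               (βz≢±z : ¬ (β (y ^ p) ≡± y ^ p))
               where
    open Subgroup K≤G
    open Twist K≤G β β-closed β-homo β-injective β-surjective using (β-ε; β-⁻¹; twist-cayIso)

    z : Fin order
    z = y ^ p

    -- connection u = A ∪ {u, u⁻¹}, where A = y K ∪ y⁻¹ K.
    InA : Pred (Fin order) 0ℓ
    InA x = y ∼ x ⊎ y ⁻¹ ∼ x

    InA? : Decidable InA
    InA? x = (y ⁻¹ ∙ x ∈? K) ⊎-dec (y ⁻¹ ⁻¹ ∙ x ∈? K)

    connection : Fin order → Subset order
    connection u = subsetOf (λ x → InA? x ⊎-dec (x ≡±? u))

    ∈-connection : ∀ {u x} → x ∈ connection u ⇔ (InA x ⊎ x ≡± u)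
    ∈-connection {u} = ∈-subsetOf (λ x → InA? x ⊎-dec (x ≡±? u))

    ±-closed : ∀ {u x} → u ∈ K → x ≡± u → x ∈ K
    ±-closed u∈K (inj₁ refl) = u∈K
    ±-closed u∈K (inj₂ refl) = ⁻¹-closed u∈K

    coset-^ : ∀ {x u} → x ∼ u → u ^ p ≡ x ^ p
    coset-^ {x} {u} x∼u = begin
      u ^ p                       ≡⟨ cong (_^ p) (\\-leftDividesˡ x u) ⟨
      (x ∙ (x ⁻¹ ∙ u)) ^ p        ≡⟨ ^-distrib-∙ x _ p ⟩
      x ^ p ∙ (x ⁻¹ ∙ u) ^ p      ≡⟨ cong (x ^ p ∙_) (K-exponent x∼u) ⟩
      x ^ p ∙ ε                   ≡⟨ identityʳ _ ⟩
      x ^ p                       ∎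

    InA-^ : ∀ {x} → InA x → x ^ p ≡± z
    InA-^ (inj₁ y∼x)  = inj₁ (coset-^ y∼x)
    InA-^ (inj₂ y⁻¹∼x) = inj₂ (trans (coset-^ y⁻¹∼x) (⁻¹-^ y p))

    ¬InA : ∀ {k} → k ∈ K → ¬ InA k
    ¬InA k∈K k∈A with InA-^ k∈A
    ... | inj₁ kᵖ≡z  = yᵖ≢ε (trans (sym kᵖ≡z) (K-exponent k∈K))
    ... | inj₂ kᵖ≡z⁻¹ = yᵖ≢ε (⁻¹-injective (trans (sym kᵖ≡z⁻¹) (trans (K-exponent k∈K) (sym ε⁻¹≈ε))))

    InA-stable : ∀ {x k} → k ∈ K → InA (x ∙ k) ⇔ InA x
    InA-stable {x} {k} k∈K = ∼-stable ⊎-⇔ ∼-stable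
      where
      x∼xk : x ∼ x ∙ k
      x∼xk = subst (_∈ K) (sym (\\-leftDividesʳ x k)) k∈K
      ∼-stable : ∀ {w} → w ∼ x ∙ k ⇔ w ∼ x
      ∼-stable = mk⇔ (λ w∼xk → ∼-trans w∼xk (∼-sym x∼xk)) (λ w∼x → ∼-trans w∼x x∼xk)

    InA-⁻¹ : ∀ {x} → InA x → InA (x ⁻¹)
    InA-⁻¹ (inj₁ y∼x)   = inj₂ (∼-⁻¹ y∼x)
    InA-⁻¹ (inj₂ y⁻¹∼x) = inj₁ (subst (_∼ _) (⁻¹-involutive y) (∼-⁻¹ y⁻¹∼x))

    connection-outside : ∀ {u x} → u ∈ K → x ∉ K → x ∈ connection u ⇔ InA x
    connection-outside u∈K x∉K = mk⇔
      ([ id , (λ x≡±u → contradiction (±-closed u∈K x≡±u) x∉K) ]′ ∘ Equivalence.to ∈-connection)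
      (Equivalence.from ∈-connection ∘ inj₁)

    connection-inside : ∀ {u k} → k ∈ K → k ∈ connection u ⇔ k ≡± u
    connection-inside k∈K = mk⇔
      ([ (λ k∈A → contradiction k∈A (¬InA k∈K)) , id ]′ ∘ Equivalence.to ∈-connection)
      (Equivalence.from ∈-connection ∘ inj₂)

    connection-invClosed : ∀ {u} → u ≢ ε → InvClosedStar G (connection u)
    connection-invClosed u≢ε =
      (λ ε∈conn → [ ¬InA ε∈ , u≢ε ∘ ε≡± ]′ (Equivalence.to ∈-connection ε∈conn)) ,
      (λ x → Equivalence.from ∈-connection ∘ ⊎-map InA-⁻¹ ≡±-⁻¹ ∘ Equivalence.to ∈-connection)

    β-≡± : ∀ {k} → k ∈ K → k ≡± z ⇔ β k ≡± β z
    β-≡± k∈K = mk⇔ (⊎-map (cong β) (λ { refl → β-⁻¹ yᵖ∈K }))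
      (⊎-map (β-injective k∈K yᵖ∈K)
             (λ βk≡βz⁻¹ → β-injective k∈K (⁻¹-closed yᵖ∈K) (trans βk≡βz⁻¹ (sym (β-⁻¹ yᵖ∈K)))))

    S≅T : CayIso G (connection z) (connection (β z))
    S≅T = twist-cayIso outside T-stable inside
      where
      βz∈K : β z ∈ K
      βz∈K = β-closed yᵖ∈K
      outside : ∀ {x} → x ∉ K → x ∈ connection z ⇔ x ∈ connection (β z)
      outside x∉K = ⇔-sym (connection-outside βz∈K x∉K) ⇔-∘ connection-outside yᵖ∈K x∉K
      T-stable : ∀ {x k} → x ∉ K → k ∈ K → x ∙ k ∈ connection (β z) ⇔ x ∈ connection (β z)
      T-stable {x} {k} x∉K k∈K = ⇔-sym (connection-outside βz∈K x∉K) ⇔-∘ (InA-stable k∈K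
                                   ⇔-∘ connection-outside βz∈K xk∉K)
        where
        xk∉K : x ∙ k ∉ K
        xk∉K xk∈K = x∉K (subst (_∈ K) (//-rightDividesʳ k x) (∙-closed xk∈K (⁻¹-closed k∈K)))
      inside : ∀ {k} → k ∈ K → k ∈ connection z ⇔ β k ∈ connection (β z)
      inside k∈K = ⇔-sym (connection-inside (β-closed k∈K)) ⇔-∘ (β-≡± k∈K ⇔-∘ connection-inside k∈K)

    βz≢ε : β z ≢ ε
    βz≢ε βz≡ε = yᵖ≢ε (β-injective yᵖ∈K ε∈ (trans βz≡ε (sym β-ε)))

    -- α y ∈ A, as elements of K have order dividing p while α y does not; hence α z = (α y) ^ p
    -- is z or z⁻¹, and these lie outside A ∪ {β z, (β z)⁻¹}.
    no-matching-automorphism : ∀ {α} → IsAut G α → ¬ (∀ x → x ∈ connection z ⇔ α x ∈ connection (β z))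
    no-matching-automorphism {α} α-aut S⇔T = βz≢±z (≡±-unique αz≡±z αz≡±βz)
      where
      open Aut α-aut using (^-homo; ε-reflect)
      αy∈A : InA (α y)
      αy∈A with Equivalence.to ∈-connection (Equivalence.to (S⇔T y) y∈S)
        where
        y∈S : y ∈ connection z
        y∈S = Equivalence.from ∈-connection (inj₁ (inj₁ (∼-refl y)))
      ... | inj₁ αy∈A    = αy∈A
      ... | inj₂ αy≡±βz = contradiction (ε-reflect (trans (^-homo y p) αyᵖ≡ε)) yᵖ≢ε
        where
        αyᵖ≡ε : α y ^ p ≡ ε
        αyᵖ≡ε = K-exponent (±-closed (β-closed yᵖ∈K) αy≡±βz)
      αz≡±z : α z ≡± z
      αz≡±z = subst (_≡± z) (sym (^-homo y p)) (InA-^ αy∈A)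
      αz≡±βz : α z ≡± β z
      αz≡±βz = Equivalence.to (connection-inside (±-closed yᵖ∈K αz≡±z))
                 (Equivalence.to (S⇔T z) (Equivalence.from ∈-connection (inj₂ (inj₁ refl))))

    not-CI : ¬ IsCI G
    not-CI isCI =
      let _ , α-aut , S⇔T = isCI (connection z) (connection (β z))
                                  (connection-invClosed yᵖ≢ε) (connection-invClosed βz≢ε) S≅T
      in no-matching-automorphism α-aut S⇔T

  Ω : ℕ → Subset order
  Ω n = subsetOf (λ x → x ^ n ≟ᶠ ε)

  ∈-Ω : ∀ n {x} → x ∈ Ω n ⇔ x ^ n ≡ ε
  ∈-Ω n = ∈-subsetOf (λ x → x ^ n ≟ᶠ ε)

  Ω⁺ : ∀ {n x} → x ^ n ≡ ε → x ∈ Ω n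
  Ω⁺ {n} = Equivalence.from (∈-Ω n)

  Ω⁻ : ∀ n {x} → x ∈ Ω n → x ^ n ≡ ε
  Ω⁻ n = Equivalence.to (∈-Ω n)

  Ω-subgroup : ∀ n → IsSubgroup G (Ω n)
  Ω-subgroup n = Ω⁺ (ε^ n) ,
    (λ x y x∈Ω y∈Ω → Ω⁺ (trans (^-distrib-∙ x y n) (trans (cong₂ _∙_ (Ω⁻ n x∈Ω) (Ω⁻ n y∈Ω)) (identityˡ ε)))) ,
    (λ x x∈Ω → Ω⁺ (trans (⁻¹-^ x n) (trans (cong _⁻¹ (Ω⁻ n x∈Ω)) ε⁻¹≈ε)))

  -- For p > 3 squaring is an automorphism of Ω p moving z = y ^ p off {z, z⁻¹}.
  no-order-p²-for-p>3 : ∀ {p y} → IsCI G → Prime p → 3 < p → y ^ p ≢ ε → (y ^ p) ^ p ≡ ε → ⊥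
  no-order-p²-for-p>3 {p} {y} isCI p-prime 3<p yᵖ≢ε zᵖ≡ε =
    NonCI.not-CI yᵖ≢ε (Ω-subgroup p) (Ω⁺ zᵖ≡ε) (Ω⁻ p) (_^ 2)
      (λ k∈Ω → Ω⁺ (^-exponent 2 (Ω⁻ p k∈Ω)))
      (λ {k} {l} _ _ → ^-distrib-∙ k l 2)
      (λ k∈Ω l∈Ω → ^-coprime-injective 2⊥p (Ω⁻ p k∈Ω) (Ω⁻ p l∈Ω))
      square-root
      z²≢±z
      isCI
    where
    2⊥p : Coprime 2 p
    2⊥p = coprime-below-prime p-prime (ℕₚ.<-trans (ℕₚ.n<1+n 2) 3<p)

    z : Fin order
    z = y ^ p

    square-root : ∀ {k} → k ∈ Ω p → ∃ λ l → l ∈ Ω p × l ^ 2 ≡ k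
    square-root {k} k∈Ω with ^-root 2⊥p (Ω⁻ p k∈Ω)
    ... | c , [k²]ᶜ≡k = k ^ c , Ω⁺ (^-exponent c (Ω⁻ p k∈Ω)) , trans (^-comm k c 2) [k²]ᶜ≡k

    z²≡z∙z : z ^ 2 ≡ z ∙ z
    z²≡z∙z = trans (^-suc z 1) (cong (z ∙_) (^-identityʳ z))

    z²≢±z : ¬ (z ^ 2 ≡± z)
    z²≢±z (inj₁ z²≡z)   = yᵖ≢ε (identityʳ-unique z z (trans (sym z²≡z∙z) z²≡z))
    z²≢±z (inj₂ z²≡z⁻¹) = yᵖ≢ε (^-coprime-trivial (coprime-below-prime p-prime 3<p)
                                  (trans (^-suc z 2) (trans (cong (z ∙_) z²≡z⁻¹) (inverseʳ z))) zᵖ≡ε)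

  infix 4 _∈⟨_⟩
  _∈⟨_⟩ : Fin order → Fin order → Set
  x ∈⟨ g ⟩ = ∃ λ n → x ≡ g ^ n

  ^-reduce : ∀ {g} n .{{_ : NonZero n}} → g ^ n ≡ ε → ∀ a → ∃ λ (i : Fin n) → g ^ a ≡ g ^ toℕ i
  ^-reduce {g} n gⁿ≡ε a =
    fromℕ< (m%n<n a n) , trans (^-mod n gⁿ≡ε a) (cong (g ^_) (sym (toℕ-fromℕ< (m%n<n a n))))

  ∈⟨⟩? : ∀ {g} n .{{_ : NonZero n}} → g ^ n ≡ ε → ∀ x → Dec (x ∈⟨ g ⟩)
  ∈⟨⟩? {g} n gⁿ≡ε x = map′ (λ (i , x≡gⁱ) → toℕ i , x≡gⁱ)
    (λ (a , x≡gᵃ) → let i , gᵃ≡gⁱ = ^-reduce n gⁿ≡ε a in i , trans x≡gᵃ gᵃ≡gⁱ)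
    (any? λ i → x ≟ᶠ g ^ toℕ i)

  small-power : ∀ {g p} → p ≤ 3 → g ^ p ≡ ε → ∀ i → i < p → g ^ i ≡ ε ⊎ g ^ i ≡± g
  small-power {g}     _   _    0 _   = inj₁ (^-zero g)
  small-power {g}     _   _    1 _   = inj₂ (inj₁ (^-identityʳ g))
  small-power {g} {p} p≤3 gᵖ≡ε 2 2<p with ℕₚ.≤-antisym p≤3 2<p
  ... | refl = inj₂ (inj₂ (sym (⁻¹≡^pred 3 gᵖ≡ε)))
  small-power         p≤3 _    (suc (suc (suc _))) 3<p =
    contradiction (ℕₚ.≤-trans 3<p p≤3) λ { (s≤s (s≤s (s≤s ()))) }

  ∈⟨⟩-small : ∀ {g p} .{{_ : NonZero p}} → p ≤ 3 → g ^ p ≡ ε → ∀ {x} → x ∈⟨ g ⟩ → x ≡ ε ⊎ x ≡± g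
  ∈⟨⟩-small {g} {p} p≤3 gᵖ≡ε (n , x≡gⁿ) with ^-reduce p gᵖ≡ε n
  ... | i , gⁿ≡gⁱ =
    subst (λ u → u ≡ ε ⊎ u ≡± g) (sym (trans x≡gⁿ gⁿ≡gⁱ)) (small-power p≤3 gᵖ≡ε (toℕ i) (toℕ<n i))

  -- K = {⟪ a , b ⟫} = ⟨z⟩ × ⟨w⟩ ≅ Z_p × Z_p, and β = swap exchanges the two coordinates.
  module CyclicSquareTimesCyclic {p} (p-prime : Prime p) {y w : Fin order} (yᵖ≢ε : y ^ p ≢ ε)
           (zᵖ≡ε : (y ^ p) ^ p ≡ ε) (wᵖ≡ε : w ^ p ≡ ε) (w∉⟨z⟩ : ¬ w ∈⟨ y ^ p ⟩) where

    private instance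
      p≢0 : NonZero p
      p≢0 = prime⇒nonZero p-prime

    z : Fin order
    z = y ^ p

    w≢ε : w ≢ ε
    w≢ε w≡ε = w∉⟨z⟩ (0 , trans w≡ε (sym (^-zero z)))

    ⟪_,_⟫ : ℕ → ℕ → Fin order
    ⟪ a , b ⟫ = z ^ a ∙ w ^ b

    ⟪⟫-∙ : ∀ a b c d → ⟪ a , b ⟫ ∙ ⟪ c , d ⟫ ≡ ⟪ a + c , b + d ⟫
    ⟪⟫-∙ a b c d = trans (interchange _ _ _ _) (sym (cong₂ _∙_ (^-homo-+ z a c) (^-homo-+ w b d)))

    ⟪⟫-exponent : ∀ a b → ⟪ a , b ⟫ ^ p ≡ ε
    ⟪⟫-exponent a b = trans (^-distrib-∙ _ _ p)
      (trans (cong₂ _∙_ (^-exponent a zᵖ≡ε) (^-exponent b wᵖ≡ε)) (identityˡ ε))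

    ⟪⟫-⁻¹ : ∀ a b → ⟪ a , b ⟫ ⁻¹ ≡ ⟪ ℕ.pred p * a , ℕ.pred p * b ⟫
    ⟪⟫-⁻¹ a b = trans (⁻¹≡^pred p (⟪⟫-exponent a b))
      (trans (^-distrib-∙ _ _ (ℕ.pred p)) (cong₂ _∙_ (^-assoc z (ℕ.pred p) a) (^-assoc w (ℕ.pred p) b)))

    ⟨w⟩∩⟨z⟩ : ∀ e f → w ^ e ≡ z ^ f → w ^ e ≡ ε
    ⟨w⟩∩⟨z⟩ e f wᵉ≡zᶠ with p ∣? e
    ... | yes p∣e = ^-∣ wᵖ≡ε p∣e
    ... | no  p∤e with ^-root (prime∤⇒coprime p-prime p∤e) wᵖ≡ε
    ...   | c , [wᵉ]ᶜ≡w = contradiction (c * f , (begin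
      w             ≡⟨ [wᵉ]ᶜ≡w ⟨
      (w ^ e) ^ c   ≡⟨ cong (_^ c) wᵉ≡zᶠ ⟩
      (z ^ f) ^ c   ≡⟨ ^-assoc z c f ⟩
      z ^ (c * f)   ∎)) w∉⟨z⟩

    ⟪⟫-injective : ∀ {a b c d} → ⟪ a , b ⟫ ≡ ⟪ c , d ⟫ → z ^ a ≡ z ^ c × w ^ b ≡ w ^ d
    ⟪⟫-injective {a} {b} {c} {d} eq = x∙y⁻¹≈ε⇒x≈y _ _ zᵃ/zᶜ≡ε , sym (x∙y⁻¹≈ε⇒x≈y _ _ wᵈ/wᵇ≡ε)
      where
      zᵃ/zᶜ≡wᵈ/wᵇ : z ^ a ∙ (z ^ c) ⁻¹ ≡ w ^ d ∙ (w ^ b) ⁻¹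
      zᵃ/zᶜ≡wᵈ/wᵇ = begin
        z ^ a ∙ (z ^ c) ⁻¹                      ≡⟨ cancel-// (w ^ b) _ _ ⟨
        (w ^ b ∙ z ^ a) ∙ (w ^ b ∙ z ^ c) ⁻¹    ≡⟨ cong (_∙ (w ^ b ∙ z ^ c) ⁻¹) (comm _ _) ⟩
        ⟪ a , b ⟫ ∙ (w ^ b ∙ z ^ c) ⁻¹          ≡⟨ cong (_∙ (w ^ b ∙ z ^ c) ⁻¹) eq ⟩
        ⟪ c , d ⟫ ∙ (w ^ b ∙ z ^ c) ⁻¹          ≡⟨ cong (λ u → ⟪ c , d ⟫ ∙ u ⁻¹) (comm _ _) ⟩
        (z ^ c ∙ w ^ d) ∙ (z ^ c ∙ w ^ b) ⁻¹    ≡⟨ cancel-// (z ^ c) _ _ ⟩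
        w ^ d ∙ (w ^ b) ⁻¹                      ∎
      wᵈ/wᵇ≡ε : w ^ d ∙ (w ^ b) ⁻¹ ≡ ε
      wᵈ/wᵇ≡ε = trans (sym (^-minus p wᵖ≡ε d b)) (⟨w⟩∩⟨z⟩ (d + ℕ.pred p * b) (a + ℕ.pred p * c)
        (trans (^-minus p wᵖ≡ε d b) (trans (sym zᵃ/zᶜ≡wᵈ/wᵇ) (sym (^-minus p zᵖ≡ε a c)))))
      zᵃ/zᶜ≡ε : z ^ a ∙ (z ^ c) ⁻¹ ≡ ε
      zᵃ/zᶜ≡ε = trans zᵃ/zᶜ≡wᵈ/wᵇ wᵈ/wᵇ≡ε

    ⟪⟫-swap-cong : ∀ {a b c d} → ⟪ a , b ⟫ ≡ ⟪ c , d ⟫ → ⟪ b , a ⟫ ≡ ⟪ d , c ⟫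
    ⟪⟫-swap-cong eq = let zᵃ≡zᶜ , wᵇ≡wᵈ = ⟪⟫-injective eq in
      cong₂ _∙_ (^-transfer p-prime w≢ε wᵖ≡ε zᵖ≡ε wᵇ≡wᵈ) (^-transfer p-prime yᵖ≢ε zᵖ≡ε wᵖ≡ε zᵃ≡zᶜ)

    InK : Pred (Fin order) 0ℓ
    InK x = ∃₂ λ a b → x ≡ ⟪ a , b ⟫

    InK? : Decidable InK
    InK? x = map′ (λ (i , j , x≡⟪ij⟫) → toℕ i , toℕ j , x≡⟪ij⟫) reduce
                  (any? λ i → any? λ j → x ≟ᶠ ⟪ toℕ i , toℕ j ⟫)
      where
      reduce : InK x → ∃₂ λ (i j : Fin p) → x ≡ ⟪ toℕ i , toℕ j ⟫
      reduce (a , b , x≡⟪ab⟫) with ^-reduce p zᵖ≡ε a | ^-reduce p wᵖ≡ε b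
      ... | i , zᵃ≡zⁱ | j , wᵇ≡wʲ = i , j , trans x≡⟪ab⟫ (cong₂ _∙_ zᵃ≡zⁱ wᵇ≡wʲ)

    K : Subset order
    K = subsetOf InK?

    ∈-K : ∀ {x} → x ∈ K ⇔ InK x
    ∈-K = ∈-subsetOf InK?

    ⟪⟫∈K : ∀ a b → ⟪ a , b ⟫ ∈ K
    ⟪⟫∈K a b = Equivalence.from ∈-K (a , b , refl)

    K-subgroup : IsSubgroup G K
    K-subgroup = subst (_∈ K) (trans (cong₂ _∙_ (^-zero z) (^-zero w)) (identityˡ ε)) (⟪⟫∈K 0 0) ,
                 (λ x y x∈K y∈K → ∙-closed (Equivalence.to ∈-K x∈K) (Equivalence.to ∈-K y∈K)) ,
                 (λ x x∈K → ⁻¹-closed (Equivalence.to ∈-K x∈K))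
      where
      ∙-closed : ∀ {x y} → InK x → InK y → x ∙ y ∈ K
      ∙-closed (a , b , refl) (c , d , refl) = subst (_∈ K) (sym (⟪⟫-∙ a b c d)) (⟪⟫∈K _ _)
      ⁻¹-closed : ∀ {x} → InK x → x ⁻¹ ∈ K
      ⁻¹-closed (a , b , refl) = subst (_∈ K) (sym (⟪⟫-⁻¹ a b)) (⟪⟫∈K _ _)

    K-exponent : ∀ {k} → k ∈ K → k ^ p ≡ ε
    K-exponent k∈K with Equivalence.to ∈-K k∈K
    ... | a , b , refl = ⟪⟫-exponent a b

    swap : Fin order → Fin order
    swap x with InK? x
    ... | yes (a , b , _) = ⟪ b , a ⟫
    ... | no  _           = x

    swap-⟪⟫ : ∀ a b → swap ⟪ a , b ⟫ ≡ ⟪ b , a ⟫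
    swap-⟪⟫ a b with InK? ⟪ a , b ⟫
    ... | yes (c , d , ⟪ab⟫≡⟪cd⟫) = sym (⟪⟫-swap-cong ⟪ab⟫≡⟪cd⟫)
    ... | no  ∉K                  = contradiction (a , b , refl) ∉K

    swap-closed : ∀ {k} → k ∈ K → swap k ∈ K
    swap-closed k∈K with Equivalence.to ∈-K k∈K
    ... | a , b , refl = subst (_∈ K) (sym (swap-⟪⟫ a b)) (⟪⟫∈K b a)

    swap-homo : ∀ {k l} → k ∈ K → l ∈ K → swap (k ∙ l) ≡ swap k ∙ swap l
    swap-homo k∈K l∈K with Equivalence.to ∈-K k∈K | Equivalence.to ∈-K l∈K
    ... | a , b , refl | c , d , refl = begin
      swap (⟪ a , b ⟫ ∙ ⟪ c , d ⟫)      ≡⟨ cong swap (⟪⟫-∙ a b c d) ⟩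
      swap ⟪ a + c , b + d ⟫            ≡⟨ swap-⟪⟫ _ _ ⟩
      ⟪ b + d , a + c ⟫                 ≡⟨ ⟪⟫-∙ b a d c ⟨
      ⟪ b , a ⟫ ∙ ⟪ d , c ⟫             ≡⟨ cong₂ _∙_ (swap-⟪⟫ a b) (swap-⟪⟫ c d) ⟨
      swap ⟪ a , b ⟫ ∙ swap ⟪ c , d ⟫   ∎

    swap-involutive : ∀ {k} → k ∈ K → swap (swap k) ≡ k
    swap-involutive k∈K with Equivalence.to ∈-K k∈K
    ... | a , b , refl = trans (cong swap (swap-⟪⟫ a b)) (swap-⟪⟫ b a)

    z≡⟪1,0⟫ : z ≡ ⟪ 1 , 0 ⟫
    z≡⟪1,0⟫ = sym (trans (cong₂ _∙_ (^-identityʳ z) (^-zero w)) (identityʳ z))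

    swap-z : swap z ≡ w
    swap-z = begin
      swap z            ≡⟨ cong swap z≡⟪1,0⟫ ⟩
      swap ⟪ 1 , 0 ⟫    ≡⟨ swap-⟪⟫ 1 0 ⟩
      z ^ 0 ∙ w ^ 1     ≡⟨ cong₂ _∙_ (^-zero z) (^-identityʳ w) ⟩
      ε ∙ w             ≡⟨ identityˡ w ⟩
      w                 ∎

    swap-z≢±z : ¬ (swap z ≡± z)
    swap-z≢±z (inj₁ βz≡z)   = w∉⟨z⟩ (1 , trans (sym swap-z) (trans βz≡z (sym (^-identityʳ z))))
    swap-z≢±z (inj₂ βz≡z⁻¹) = w∉⟨z⟩ (ℕ.pred p , trans (sym swap-z) (trans βz≡z⁻¹ (⁻¹≡^pred p zᵖ≡ε)))

    not-CI : ¬ IsCI G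
    not-CI = NonCI.not-CI yᵖ≢ε K-subgroup (subst (_∈ K) (sym z≡⟪1,0⟫) (⟪⟫∈K 1 0)) K-exponent swap
      swap-closed swap-homo
      (λ k∈K l∈K swapk≡swapl →
         trans (sym (swap-involutive k∈K)) (trans (cong swap swapk≡swapl) (swap-involutive l∈K)))
      (λ {k} k∈K → swap k , swap-closed k∈K , swap-involutive k∈K)
      swap-z≢±z

  Ω* : ℕ → Pred (Fin order) 0ℓ
  Ω* n x = x ^ n ≡ ε × x ≢ ε

  Characteristic : Pred (Fin order) 0ℓ → Set
  Characteristic E = ∀ {α} → IsAut G α → ∀ x → E x ⇔ E (α x)

  Ω*-characteristic : ∀ n → Characteristic (Ω* n)
  Ω*-characteristic n {α} α-aut x = mk⇔
    (λ (xⁿ≡ε , x≢ε) → trans (sym (^-homo x n)) (trans (cong α xⁿ≡ε) ε-homo) , x≢ε ∘ ε-reflect)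
    (λ (αxⁿ≡ε , αx≢ε) → ε-reflect (trans (^-homo x n) αxⁿ≡ε) , λ x≡ε → αx≢ε (trans (cong α x≡ε) ε-homo))
    where open Aut α-aut

  module KIf (isCI : IsCI G) {k S} (P : Fin k → Subset order) (P-partition : IsInvClosedPartition G k P)
             (i₀ : Fin k) (Pi₀≡S : P i₀ ≡ S) (P≅S : ∀ i → CayIso G (P i) S) where

    private
      invClosed = proj₁ P-partition
      disjoint  = proj₁ (proj₂ (proj₂ P-partition))
      cover     = proj₂ (proj₂ (proj₂ P-partition))

      matching : ∀ i → Σ (Fin order → Fin order) λ α → IsAut G α × (∀ x → x ∈ P i ⇔ α x ∈ S)
      matching i = isCI (P i) S (invClosed i) (subst (InvClosedStar G) Pi₀≡S (invClosed i₀)) (P≅S i)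

    -- By the CI property every part P i is the preimage of S under an automorphism.
    characteristic-meets-every-part : ∀ {E} → Characteristic E → ∀ {i x} → x ∈ P i → E x →
                                      ∀ j → ∃ λ u → u ∈ P j × E u
    characteristic-meets-every-part {E} char {i} {x} x∈Pi Ex j with matching i | matching j
    ... | α , α-aut , Pi⇔S | β , β-aut , Pj⇔S with Aut.surjective β-aut (α x)
    ... | u , βu≡αx =
      u , Equivalence.from (Pj⇔S u) (subst (_∈ S) (sym βu≡αx) (Equivalence.to (Pi⇔S x) x∈Pi)) ,
          Equivalence.from (char β-aut u) (subst E (sym βu≡αx) (Equivalence.to (char α-aut x) Ex))

    characteristic-not-within-pair : 2 ≤ k → ∀ {E} → Characteristic E → ∀ {z} → z ≢ ε → E z →
                                     ¬ (∀ x → E x → x ≡± z)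
    characteristic-not-within-pair 2≤k char {z} z≢ε Ez E⊆±z with cover z z≢ε
    ... | a , z∈Pa with other-index 2≤k a
    ... | b , a≢b with characteristic-meets-every-part char z∈Pa Ez b
    ... | u , u∈Pb , Eu = disjoint a b u a≢b (±z∈Pa (E⊆±z u Eu)) u∈Pb
      where
      ±z∈Pa : ∀ {u} → u ≡± z → u ∈ P a
      ±z∈Pa (inj₁ refl) = z∈Pa
      ±z∈Pa (inj₂ refl) = proj₂ (invClosed a) z z∈Pa

  element-of-order-p² : ∀ {p x} a → x ^ (p ℕ.^ a) ≡ ε → x ^ p ≢ ε → ∃ λ y → y ^ p ≢ ε × (y ^ p) ^ p ≡ ε
  element-of-order-p² {p} {x} zero x¹≡ε xᵖ≢ε =
    contradiction (trans (cong (_^ p) (trans (sym (^-identityʳ x)) x¹≡ε)) (ε^ p)) xᵖ≢ε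
  element-of-order-p² {p} {x} (suc a) xᵖᵃ⁺¹≡ε xᵖ≢ε with (x ^ p) ^ p ≟ᶠ ε
  ... | yes xᵖᵖ≡ε = x , xᵖ≢ε , xᵖᵖ≡ε
  ... | no  xᵖᵖ≢ε = element-of-order-p² a
    (trans (^-assoc x _ p) (trans (cong (x ^_) (ℕₚ.*-comm (p ℕ.^ a) p)) xᵖᵃ⁺¹≡ε)) xᵖᵖ≢ε

  no-order-p² : ∀ {k p y} → IsCI G → HasKIf G k → 2 ≤ k → Prime p → y ^ p ≢ ε → (y ^ p) ^ p ≡ ε → ⊥
  no-order-p² {k} {p} {y} isCI (S , P , P-partition , (i₀ , Pi₀≡S) , P≅S) 2≤k p-prime yᵖ≢ε zᵖ≡ε with 3 <? p
  ... | yes 3<p = no-order-p²-for-p>3 isCI p-prime 3<p yᵖ≢ε zᵖ≡ε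
  ... | no  3≮p with any? (λ w → (w ^ p ≟ᶠ ε) ×-dec ¬? (∈⟨⟩? p ⦃ prime⇒nonZero p-prime ⦄ zᵖ≡ε w))
  ...   | yes (w , wᵖ≡ε , w∉⟨z⟩) = CyclicSquareTimesCyclic.not-CI p-prime yᵖ≢ε zᵖ≡ε wᵖ≡ε w∉⟨z⟩ isCI
  ...   | no  ∄w = KIf.characteristic-not-within-pair isCI P P-partition i₀ Pi₀≡S P≅S 2≤k
                     (Ω*-characteristic p) yᵖ≢ε (zᵖ≡ε , yᵖ≢ε) Ω*⊆±z
    where
    instance
      p≢0 : NonZero p
      p≢0 = prime⇒nonZero p-prime
    Ω*⊆±z : ∀ x → Ω* p x → x ≡± y ^ p
    Ω*⊆±z x (xᵖ≡ε , x≢ε) with ∈⟨⟩? p zᵖ≡ε x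
    ... | no  x∉⟨z⟩ = contradiction (x , xᵖ≡ε , x∉⟨z⟩) ∄w
    ... | yes x∈⟨z⟩ = [ (λ x≡ε → contradiction x≡ε x≢ε) , id ]′ (∈⟨⟩-small (ℕₚ.≮⇒≥ 3≮p) zᵖ≡ε x∈⟨z⟩)

corollary4p4 : (k : ℕ) → 2 ≤ k → (G : FinGroup) → Abelian G → IsCI G → HasKIf G k →
    ∀ p H → IsSylow G p H → ElementaryAbelianP G p H
corollary4p4 k 2≤k G comm isCI kIf p H (p-prime , H≤G , a , ∣H∣≡pᵃ , _) =
  (λ x y _ _ → comm x y) , λ x x∈H → trans (pow≡^ x p) (decidable-stable (x ^ p ≟ᶠ ε) λ xᵖ≢ε →
    let y , yᵖ≢ε , zᵖ≡ε = element-of-order-p² a (subst (λ n → x ^ n ≡ ε) ∣H∣≡pᵃ (lagrange x∈H)) xᵖ≢ε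
    in no-order-p² isCI kIf 2≤k p-prime yᵖ≢ε zᵖ≡ε)
  where
  open AbelianFinGroup G comm
  open Subgroup H≤G
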